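{- Let $m$ be an odd positive integer and let $M=\{a_1,\dots,a_m\}$ be a multiset of $m$ elements of $\mathbb{Z}_m$. A permutational sum of $M$ is any element of the form $\sum_{i=1}^m i a_{\pi(i)}\in\mathbb{Z}_m$ with $\pi\in S_m$. (i) If no permutational sum of $M$ equals $0$, then no permutational sum of the translate $M+c=\{a_1+c,\dots,a_m+c\}$ equals $0$ for any $c\in\mathbb{Z}_m$, and no permutational sum of the dilate $cM=\{ca_1,\dots,ca_m\}$ equals $0$ for any $c$ with $\gcd(c,m)=1$. (ii) If some permutational sum of $M$ equals $w$, then for every integer $k$ with $\gcd(k,m)=1$ some permutational sum of $M$ equals $kw$. Consequently, if $\gcd(w,m)=1$, then the permutational sums of $M$ take at least $\varphi(m)$ distinct values. (iii) If $M=\{a,\dots,a,a+b,a-b\}$ (with $m-2$ copies of $a$) where $\gcd(b,m)=1$, then every nonzero element of $\mathbb{Z}_m$ is a permutational sum of $M$, and $0$ is not.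
   Context: $\varphi$ denotes Euler's totient function. -}

module Defs where

open import Data.Nat as ℕ using (ℕ)
open import Data.Integer using (ℤ; +_; _+_; _-_; _*_; 0ℤ)
open import Data.Integer.Divisibility using (_∣_)
open import Data.Fin using (Fin; zero; suc; toℕ)
open import Data.Fin.Permutation using (Permutation′; _⟨$⟩ʳ_)
open import Data.Nat.Coprimality using (coprime?)
open import Data.List using (List; length; filter; map; upTo)
open import Data.Product using (∃)
open import Relation.Binary.PropositionalEquality using (_≡_)

_≡_[mod_] : ℤ → ℤ → ℕ → Set
a ≡ b [mod m ] = (+ m) ∣ (a - b)

sumFin : (n : ℕ) → (Fin n → ℤ) → ℤ
sumFin ℕ.zero    f = 0ℤ
sumFin (ℕ.suc n) f = f zero + sumFin n (λ i → f (suc i))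

-- the permutational sum  Σ_{i=1}^m i · a_{π(i)}  (Fin index i stands for i+1)
permSum : (m : ℕ) → (Fin m → ℤ) → Permutation′ m → ℤ
permSum m a π = sumFin m (λ i → + (ℕ.suc (toℕ i)) * a (π ⟨$⟩ʳ i))

IsPermSum : (m : ℕ) → (Fin m → ℤ) → ℤ → Set
IsPermSum m a w = ∃ λ (π : Permutation′ m) → permSum m a π ≡ w [mod m ]

φ : ℕ → ℕ
φ n = length (filter (λ k → coprime? k n) (map ℕ.suc (upTo n)))

specialSeq : (m : ℕ) → ℤ → ℤ → Fin m → ℤ
specialSeq _ a b zero          = a + b
specialSeq _ a b (suc zero)    = a - b
specialSeq _ a b (suc (suc _)) = a

module Submission where

-- Write a permutational sum as Σⱼ pⱼ aⱼ, where pⱼ ∈ {1, …, m} is the place given to aⱼ; the pⱼ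
-- are a permutation of 1, …, m. Multiplication by a unit k permutes the residues 1, …, m; for
-- k = -1 this gives Σ pⱼ ≡ -Σ pⱼ, so Σ pⱼ ≡ 0 for odd m. Hence translating the multiset leaves
-- its permutational sums unchanged and dilating it by a unit multiplies them by that unit (i).
-- Multiplying all places by a unit k turns a permutational sum w into k w, and the φ(m) units
-- in 1, …, m give pairwise incongruent multiples of a unit w (ii). For {a + b, a - b, a, …, a}
-- the sum is b (p₀ - p₁): it vanishes only if p₀ = p₁, and b t is reached by putting a - b in
-- place 1 and a + b in place t + 1 (iii).

open import Data.Nat as ℕ using (ℕ; zero; suc; _≤_; 2+; s≤s; NonZero)
open import Data.Nat.Divisibility as ℕD using ()
open import Data.Nat.Coprimality as Coprimality using (Coprime; coprime?; 1-coprimeTo; coprime-Bézout)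
open import Data.Nat.GCD using (module Bézout)
open import Data.Nat.Primality using (irreducible[2])
import Data.Nat.Properties as ℕP
open import Data.Integer as ℤ using (ℤ; +_; -[1+_]; _+_; _-_; _*_; -_; ∣_∣; 0ℤ; 1ℤ; -1ℤ)
import Data.Integer.Properties as ℤP
import Data.Integer.Coprimality as ℤCoprimality
open import Data.Integer.Divisibility.Signed using (_∣_; divides; ∣ᵤ⇒∣; ∣⇒∣ᵤ; ∣m⇒∣-m; ∣m∣n⇒∣m+n; ∣n⇒∣m*n)
import Data.Integer.DivMod as DM
open import Data.Integer.Tactic.RingSolver using (solve-∀)
open import Data.Fin as Fin using (Fin; toℕ; fromℕ<)
open import Data.Fin.Patterns using (0F; 1F)
import Data.Fin.Properties as FinP
open import Data.Fin.Permutation as Perm using (Permutation′; _⟨$⟩ʳ_; _⟨$⟩ˡ_; _∘ₚ_)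
import Data.Fin.Permutation.Components as PC
open import Data.List using (List; _∷_; filter; map; upTo; lookup)
import Data.List.Relation.Unary.All as All
open import Data.List.Relation.Unary.AllPairs using (_∷_)
open import Data.List.Relation.Unary.Unique.Propositional using (Unique)
import Data.List.Relation.Unary.Unique.Propositional.Properties as Unique
open import Data.List.Membership.Propositional using (_∈_)
import Data.List.Membership.Propositional.Properties as ∈
open import Data.Product using (_×_; _,_; ∃; proj₁; proj₂)
open import Data.Sum using (inj₁; inj₂)
open import Function using (_∘_)
open import Relation.Nullary using (¬_; contradiction; yes; no)
open import Relation.Nullary.Decidable using (dec-true; dec-false)
open import Relation.Binary using (IsEquivalence; Setoid)
import Relation.Binary.Reasoning.Setoid as SetoidReasoning
open import Relation.Binary.PropositionalEquality
open import Algebra.Properties.Semiring.Sum ℤP.+-*-semiring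
  using (sum; sum-syntax; ∑-distrib-+; *-distribˡ-sum; *-distribʳ-sum; sum-permute; sum-cong-≗)

open import Defs

∣∧<⇒≡0 : ∀ {m n} → m ℕD.∣ n → n ℕ.< m → n ≡ 0
∣∧<⇒≡0 {n = zero}  _   _   = refl
∣∧<⇒≡0 {n = suc _} m∣n n<m = contradiction (ℕD.∣⇒≤ m∣n) (ℕP.<⇒≱ n<m)

odd⇒coprime-2 : ∀ {m} → ¬ 2 ℕD.∣ m → Coprime 2 m
odd⇒coprime-2 2∤m (d∣2 , d∣m) with irreducible[2] d∣2
... | inj₁ d≡1 = d≡1
... | inj₂ refl = contradiction d∣m 2∤m

lookup-injective : ∀ {A : Set} {xs : List A} → Unique xs →
                   ∀ {i j} → lookup xs i ≡ lookup xs j → i ≡ j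
lookup-injective {xs = _ ∷ _} (_ ∷ _)       {0F}        {0F}        _ = refl
lookup-injective {xs = _ ∷ _} (x∉xs ∷ _)    {0F}        {Fin.suc j} e =
  contradiction e (All.lookup x∉xs (∈.∈-lookup j))
lookup-injective {xs = _ ∷ _} (x∉xs ∷ _)    {Fin.suc i} {0F}        e =
  contradiction (sym e) (All.lookup x∉xs (∈.∈-lookup i))
lookup-injective {xs = _ ∷ _} (_ ∷ unique)  {Fin.suc i} {Fin.suc j} e =
  cong Fin.suc (lookup-injective unique e)

transpose-matchˡ : ∀ {n} (i j : Fin n) → PC.transpose i j i ≡ j
transpose-matchˡ i j rewrite dec-true (i FinP.≟ i) refl = refl

transpose-matchʳ : ∀ {n} (i j : Fin n) → PC.transpose i j j ≡ i
transpose-matchʳ i j with i FinP.≟ j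
... | yes refl = transpose-matchˡ i i
... | no i≢j rewrite dec-false (j FinP.≟ i) (i≢j ∘ sym) | dec-true (j FinP.≟ j) refl = refl

transpose-mismatch : ∀ {n} {i j k : Fin n} → k ≢ i → k ≢ j → PC.transpose i j k ≡ k
transpose-mismatch {i = i} {j} {k} k≢i k≢j
  rewrite dec-false (k FinP.≟ i) k≢i | dec-false (k FinP.≟ j) k≢j = refl

-- the cycle 0 ↦ p ↦ 1 ↦ 0 (a transposition when p = 1)
cycle-0p1 : ∀ {n} → Fin (2+ n) → Permutation′ (2+ n)
cycle-0p1 p = Perm.transpose 1F p ∘ₚ Perm.transpose 0F p

cycle-0p1-0 : ∀ {n} (p : Fin (2+ n)) → p ≢ 0F → cycle-0p1 p ⟨$⟩ʳ 0F ≡ p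
cycle-0p1-0 p p≢0 =
  trans (cong (PC.transpose 0F p) (transpose-mismatch {i = 1F} {p} {0F} (λ ()) (p≢0 ∘ sym)))
        (transpose-matchˡ 0F p)

cycle-0p1-1 : ∀ {n} (p : Fin (2+ n)) → cycle-0p1 p ⟨$⟩ʳ 1F ≡ 0F
cycle-0p1-1 p = trans (cong (PC.transpose 0F p) (transpose-matchˡ 1F p)) (transpose-matchʳ 0F p)

ι : ∀ {m} → Fin m → ℤ
ι i = + suc (toℕ i)

sumFin≡sum : ∀ n (f : Fin n → ℤ) → sumFin n f ≡ sum f
sumFin≡sum zero    f = refl
sumFin≡sum (suc n) f = cong (_+_ (f 0F)) (sumFin≡sum n (f ∘ Fin.suc))

module _ {m : ℕ} where

  permSum≡∑ : ∀ a π → permSum m a π ≡ ∑[ i < m ] (ι i * a (π ⟨$⟩ʳ i))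
  permSum≡∑ a π = sumFin≡sum m _

  permSum-translate : ∀ a c π → permSum m (λ i → a i + c) π ≡ permSum m a π + (∑[ i < m ] ι i) * c
  permSum-translate a c π = begin
    permSum m (λ i → a i + c) π
      ≡⟨ permSum≡∑ (λ i → a i + c) π ⟩
    ∑[ i < m ] (ι i * (a (π ⟨$⟩ʳ i) + c))
      ≡⟨ sum-cong-≗ (λ i → ℤP.*-distribˡ-+ (ι i) (a (π ⟨$⟩ʳ i)) c) ⟩
    ∑[ i < m ] (ι i * a (π ⟨$⟩ʳ i) + ι i * c)
      ≡⟨ ∑-distrib-+ (λ i → ι i * a (π ⟨$⟩ʳ i)) (λ i → ι i * c) ⟩
    ∑[ i < m ] (ι i * a (π ⟨$⟩ʳ i)) + ∑[ i < m ] (ι i * c)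
      ≡⟨ cong₂ _+_ (permSum≡∑ a π) (*-distribʳ-sum c (ι {m})) ⟨
    permSum m a π + (∑[ i < m ] ι i) * c
      ∎
    where open ≡-Reasoning

  permSum-dilate : ∀ a c π → permSum m (λ i → c * a i) π ≡ c * permSum m a π
  permSum-dilate a c π = begin
    permSum m (λ i → c * a i) π            ≡⟨ permSum≡∑ (λ i → c * a i) π ⟩
    ∑[ i < m ] (ι i * (c * a (π ⟨$⟩ʳ i)))  ≡⟨ sum-cong-≗ (λ i → swap (ι i) c (a (π ⟨$⟩ʳ i))) ⟩
    ∑[ i < m ] (c * (ι i * a (π ⟨$⟩ʳ i)))  ≡⟨ *-distribˡ-sum c (λ i → ι i * a (π ⟨$⟩ʳ i)) ⟨
    c * ∑[ i < m ] (ι i * a (π ⟨$⟩ʳ i))    ≡⟨ cong (c *_) (permSum≡∑ a π) ⟨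
    c * permSum m a π                      ∎
    where
      open ≡-Reasoning
      swap : ∀ x c y → x * (c * y) ≡ c * (x * y)
      swap = solve-∀

  position : Permutation′ m → Fin m → ℤ
  position π j = ι (π ⟨$⟩ˡ j)

  permSum≡∑position : ∀ a π → permSum m a π ≡ ∑[ j < m ] (position π j * a j)
  permSum≡∑position a π = begin
    permSum m a π
      ≡⟨ permSum≡∑ a π ⟩
    ∑[ i < m ] (ι i * a (π ⟨$⟩ʳ i))
      ≡⟨ sum-permute (λ i → ι i * a (π ⟨$⟩ʳ i)) (Perm.flip π) ⟩
    ∑[ j < m ] (position π j * a (π ⟨$⟩ʳ (π ⟨$⟩ˡ j)))
      ≡⟨ sum-cong-≗ (λ j → cong (λ i → position π j * a i) (Perm.inverseʳ π)) ⟩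
    ∑[ j < m ] (position π j * a j)
      ∎
    where open ≡-Reasoning

  ∑position≡∑ι : ∀ π → ∑[ j < m ] position π j ≡ ∑[ i < m ] ι i
  ∑position≡∑ι π = sym (sum-permute (ι {m}) (Perm.flip π))

module Congruence (m : ℕ) where

  -- A record rather than a synonym for _≡_[mod m ], so that x and y can be inferred from a proof.
  infix 4 _≈_
  record _≈_ (x y : ℤ) : Set where
    constructor mk≈
    field m∣x-y : + m ∣ x - y

  ≈⇒≡[mod] : ∀ {x y} → x ≈ y → x ≡ y [mod m ]
  ≈⇒≡[mod] (mk≈ m∣x-y) = ∣⇒∣ᵤ m∣x-y

  ≡[mod]⇒≈ : ∀ {x y} → x ≡ y [mod m ] → x ≈ y
  ≡[mod]⇒≈ m∣x-y = mk≈ (∣ᵤ⇒∣ m∣x-y)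

  ≈-intro : ∀ {x y} q → x ≡ y + q * + m → x ≈ y
  ≈-intro {y = y} q refl = mk≈ (divides q (cancel y (q * + m)))
    where
      cancel : ∀ y z → y + z - y ≡ z
      cancel = solve-∀

  ≡⇒≈ : ∀ {x y} → x ≡ y → x ≈ y
  ≡⇒≈ {x} refl = ≈-intro 0ℤ (sym (ℤP.+-identityʳ x))

  ≈-refl : ∀ {x} → x ≈ x
  ≈-refl = ≡⇒≈ refl

  ≈-sym : ∀ {x y} → x ≈ y → y ≈ x
  ≈-sym {x} {y} (mk≈ d) = mk≈ (subst (+ m ∣_) (negate x y) (∣m⇒∣-m d))
    where
      negate : ∀ x y → - (x - y) ≡ y - x
      negate = solve-∀

  ≈-trans : ∀ {x y z} → x ≈ y → y ≈ z → x ≈ z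
  ≈-trans {x} {y} {z} (mk≈ d) (mk≈ e) = mk≈ (subst (+ m ∣_) (telescope x y z) (∣m∣n⇒∣m+n d e))
    where
      telescope : ∀ x y z → (x - y) + (y - z) ≡ x - z
      telescope = solve-∀

  ≈-isEquivalence : IsEquivalence _≈_
  ≈-isEquivalence = record { refl = ≈-refl ; sym = ≈-sym ; trans = ≈-trans }

  ≈-setoid : Setoid _ _
  ≈-setoid = record { isEquivalence = ≈-isEquivalence }

  module ≈-Reasoning = SetoidReasoning ≈-setoid

  +-cong : ∀ {x y u v} → x ≈ y → u ≈ v → x + u ≈ y + v
  +-cong {x} {y} {u} {v} (mk≈ d) (mk≈ e) = mk≈ (subst (+ m ∣_) (regroup x y u v) (∣m∣n⇒∣m+n d e))
    where
      regroup : ∀ x y u v → (x - y) + (u - v) ≡ (x + u) - (y + v)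
      regroup = solve-∀

  private
    *-distribˡ-- : ∀ c x y → c * (x - y) ≡ c * x - c * y
    *-distribˡ-- = solve-∀

  *-congˡ : ∀ c {x y} → x ≈ y → c * x ≈ c * y
  *-congˡ c {x} {y} (mk≈ d) = mk≈ (subst (+ m ∣_) (*-distribˡ-- c x y) (∣n⇒∣m*n c d))

  *-congʳ : ∀ c {x y} → x ≈ y → x * c ≈ y * c
  *-congʳ c {x} {y} x≈y =
    ≈-trans (≡⇒≈ (ℤP.*-comm x c)) (≈-trans (*-congˡ c x≈y) (≡⇒≈ (ℤP.*-comm c y)))

  +-cancelˡ-≈ : ∀ c {x y} → c + x ≈ c + y → x ≈ y
  +-cancelˡ-≈ c {x} {y} c+x≈c+y =
    ≈-trans (≡⇒≈ (unshift c x)) (≈-trans (+-cong (≈-refl { - c}) c+x≈c+y) (≡⇒≈ (sym (unshift c y))))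
    where
      unshift : ∀ c z → z ≡ - c + (c + z)
      unshift = solve-∀

  x-y≈0⇒x≈y : ∀ {x y} → x - y ≈ 0ℤ → x ≈ y
  x-y≈0⇒x≈y {x} {y} (mk≈ d) = mk≈ (subst (+ m ∣_) (ℤP.+-identityʳ (x - y)) d)

  *-cancelˡ-≈ : ∀ c {x y} → Coprime ∣ c ∣ m → c * x ≈ c * y → x ≈ y
  *-cancelˡ-≈ c {x} {y} c⊥m (mk≈ d) =
    mk≈ (∣ᵤ⇒∣ (ℤCoprimality.coprime-divisor (+ m) c (x - y) (Coprimality.sym c⊥m)
                (∣⇒∣ᵤ (subst (+ m ∣_) (sym (*-distribˡ-- c x y)) d))))

  ∑-cong-≈ : ∀ {n} {f g : Fin n → ℤ} → (∀ i → f i ≈ g i) → sum f ≈ sum g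
  ∑-cong-≈ {zero}  _   = ≈-refl
  ∑-cong-≈ {suc n} f≈g = +-cong (f≈g 0F) (∑-cong-≈ (f≈g ∘ Fin.suc))

  ∃-inverse : ∀ k → Coprime ∣ k ∣ m → ∃ λ u → u * k ≈ 1ℤ
  ∃-inverse (+ a) a⊥m with coprime-Bézout a⊥m
  ... | Bézout.+- x y 1+ym≡xa = + x , ≈-intro (+ y) (begin
    + x * + a          ≡⟨ sym (ℤP.pos-* x a) ⟩
    + (x ℕ.* a)        ≡⟨ cong +_ (sym 1+ym≡xa) ⟩
    1ℤ + + (y ℕ.* m)   ≡⟨ cong (_+_ 1ℤ) (ℤP.pos-* y m) ⟩
    1ℤ + + y * + m     ∎)
    where open ≡-Reasoning
  ... | Bézout.-+ x y 1+xa≡ym = - + x , ≈-intro (- + y) (begin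
    - + x * + a              ≡⟨ shift (+ x) (+ a) ⟩
    1ℤ + - (1ℤ + + x * + a)  ≡⟨ cong (λ z → 1ℤ + - (1ℤ + z)) (sym (ℤP.pos-* x a)) ⟩
    1ℤ + - + (1 ℕ.+ x ℕ.* a) ≡⟨ cong (λ z → 1ℤ + - + z) 1+xa≡ym ⟩
    1ℤ + - + (y ℕ.* m)       ≡⟨ cong (λ z → 1ℤ + - z) (ℤP.pos-* y m) ⟩
    1ℤ + - (+ y * + m)       ≡⟨ cong (_+_ 1ℤ) (ℤP.neg-distribˡ-* (+ y) (+ m)) ⟩
    1ℤ + - + y * + m         ∎)
    where
      open ≡-Reasoning
      shift : ∀ x a → - x * a ≡ 1ℤ + - (1ℤ + x * a)
      shift = solve-∀
  ∃-inverse -[1+ a ] a⊥m with ∃-inverse (+ suc a) a⊥m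
  ... | u , u*a≈1 = - u , ≈-trans (≡⇒≈ (neg*neg u (+ suc a))) u*a≈1
    where
      neg*neg : ∀ u x → - u * - x ≡ u * x
      neg*neg = solve-∀

module Residues (m : ℕ) .{{_ : NonZero m}} where
  open Congruence m

  residue : ℤ → Fin m
  residue t = fromℕ< (DM.n%ℕd<d (t - 1ℤ) m)

  ι-residue : ∀ t → ι (residue t) ≈ t
  ι-residue t = ≈-sym (≈-intro q (begin
    t                       ≡⟨ shift t ⟩
    1ℤ + (t - 1ℤ)           ≡⟨ cong (_+_ 1ℤ) (DM.a≡a%ℕn+[a/ℕn]*n (t - 1ℤ) m) ⟩
    1ℤ + (+ r + q * + m)    ≡⟨ ℤP.+-assoc 1ℤ (+ r) (q * + m) ⟨
    + suc r + q * + m       ≡⟨ cong (λ k → + suc k + q * + m) (FinP.toℕ-fromℕ< _) ⟨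
    ι (residue t) + q * + m ∎))
    where
      open ≡-Reasoning
      r = (t - 1ℤ) DM.%ℕ m
      q = (t - 1ℤ) DM./ℕ m
      shift : ∀ t → t ≡ 1ℤ + (t - 1ℤ)
      shift = solve-∀

  private
    ≈⇒≡-ordered : ∀ {x y} → x ≤ y → y ℕ.< m → + x ≈ + y → x ≡ y
    ≈⇒≡-ordered {x} {y} x≤y y<m (mk≈ d) =
      ℕP.≤-antisym x≤y (ℕP.m∸n≡0⇒m≤n (∣∧<⇒≡0 m∣y∸x (ℕP.≤-<-trans (ℕP.m∸n≤m y x) y<m)))
      where
        m∣y∸x : m ℕD.∣ y ℕ.∸ x
        m∣y∸x = subst (m ℕD.∣_) (trans (cong ∣_∣ (ℤP.m-n≡m⊖n x y)) (ℤP.∣⊖∣-≤ x≤y)) (∣⇒∣ᵤ d)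

  ≈⇒≡-below : ∀ {x y} → x ℕ.< m → y ℕ.< m → + x ≈ + y → x ≡ y
  ≈⇒≡-below {x} {y} x<m y<m x≈y with ℕP.≤-total x y
  ... | inj₁ x≤y = ≈⇒≡-ordered x≤y y<m x≈y
  ... | inj₂ y≤x = sym (≈⇒≡-ordered y≤x x<m (≈-sym x≈y))

  ι-injective : ∀ {i j : Fin m} → ι i ≈ ι j → i ≡ j
  ι-injective {i} {j} ιi≈ιj =
    FinP.toℕ-injective (≈⇒≡-below (FinP.toℕ<n i) (FinP.toℕ<n j) (+-cancelˡ-≈ 1ℤ ιi≈ιj))

  multiply : ℤ → Fin m → Fin m
  multiply k i = residue (k * ι i)

  multiply-inverse : ∀ u k → u * k ≈ 1ℤ → ∀ i → multiply u (multiply k i) ≡ i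
  multiply-inverse u k u*k≈1 i = ι-injective (begin
    ι (multiply u (multiply k i)) ≈⟨ ι-residue _ ⟩
    u * ι (multiply k i)          ≈⟨ *-congˡ u (ι-residue _) ⟩
    u * (k * ι i)                 ≡⟨ ℤP.*-assoc u k (ι i) ⟨
    u * k * ι i                   ≈⟨ *-congʳ (ι i) u*k≈1 ⟩
    1ℤ * ι i                      ≡⟨ ℤP.*-identityˡ (ι i) ⟩
    ι i                           ∎)
    where open ≈-Reasoning

  scale : ∀ k → Coprime ∣ k ∣ m → Permutation′ m
  scale k k⊥m = Perm.permutation (multiply k) (multiply u) (multiply-inverse k u k*u≈1) (multiply-inverse u k u*k≈1)
    where
      u : ℤ
      u = proj₁ (∃-inverse k k⊥m)
      u*k≈1 : u * k ≈ 1ℤ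
      u*k≈1 = proj₂ (∃-inverse k k⊥m)
      k*u≈1 : k * u ≈ 1ℤ
      k*u≈1 = ≈-trans (≡⇒≈ (ℤP.*-comm k u)) u*k≈1

  ι-scale : ∀ k (k⊥m : Coprime ∣ k ∣ m) i → ι (scale k k⊥m ⟨$⟩ʳ i) ≈ k * ι i
  ι-scale k _ i = ι-residue (k * ι i)

  ∑ι≈0 : ¬ 2 ℕD.∣ m → ∑[ i < m ] ι i ≈ 0ℤ
  ∑ι≈0 2∤m = *-cancelˡ-≈ (+ 2) (odd⇒coprime-2 2∤m) (begin
    + 2 * S        ≡⟨ double S ⟩
    S + S          ≈⟨ +-cong S≈-S ≈-refl ⟩
    -1ℤ * S + S    ≡⟨ cancel S ⟩
    + 2 * 0ℤ       ∎)
    where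
      open ≈-Reasoning
      S = ∑[ i < m ] ι i
      σ = scale -1ℤ (1-coprimeTo m)
      S≈-S : S ≈ -1ℤ * S
      S≈-S = begin
        S                             ≡⟨ sum-permute (ι {m}) σ ⟩
        ∑[ i < m ] ι (σ ⟨$⟩ʳ i)       ≈⟨ ∑-cong-≈ (ι-scale -1ℤ (1-coprimeTo m)) ⟩
        ∑[ i < m ] (-1ℤ * ι i)        ≡⟨ *-distribˡ-sum -1ℤ (ι {m}) ⟨
        -1ℤ * S                       ∎
      double : ∀ s → + 2 * s ≡ s + s
      double = solve-∀
      cancel : ∀ s → -1ℤ * s + s ≡ 0ℤ
      cancel = solve-∀

module PermutationalSums (m : ℕ) .{{_ : NonZero m}} where
  open Congruence m
  open Residues m
  open ≈-Reasoning

  IsPermSum-translate : ¬ 2 ℕD.∣ m → ∀ a c {w} → IsPermSum m (λ i → a i + c) w → IsPermSum m a w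
  IsPermSum-translate 2∤m a c {w} (π , s) = π , ≈⇒≡[mod] (begin
    permSum m a π                         ≡⟨ ℤP.+-identityʳ _ ⟨
    permSum m a π + 0ℤ                    ≈⟨ +-cong (≈-refl {permSum m a π}) (*-congʳ c (∑ι≈0 2∤m)) ⟨
    permSum m a π + (∑[ i < m ] ι i) * c  ≡⟨ permSum-translate a c π ⟨
    permSum m (λ i → a i + c) π           ≈⟨ ≡[mod]⇒≈ s ⟩
    w                                     ∎)

  IsPermSum-dilate : ∀ a c {w} → Coprime ∣ c ∣ m → IsPermSum m (λ i → c * a i) (c * w) → IsPermSum m a w
  IsPermSum-dilate a c c⊥m (π , s) =
    π , ≈⇒≡[mod] (*-cancelˡ-≈ c c⊥m (≈-trans (≡⇒≈ (sym (permSum-dilate a c π))) (≡[mod]⇒≈ s)))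

  IsPermSum-*ˡ : ∀ a {w} k → Coprime ∣ k ∣ m → IsPermSum m a w → IsPermSum m a (k * w)
  IsPermSum-*ˡ a {w} k k⊥m (π , s) = Perm.flip σ ∘ₚ π , ≈⇒≡[mod] (begin
    permSum m a (Perm.flip σ ∘ₚ π)
      ≡⟨ permSum≡∑position a (Perm.flip σ ∘ₚ π) ⟩
    ∑[ j < m ] (ι (σ ⟨$⟩ʳ (π ⟨$⟩ˡ j)) * a j)
      ≈⟨ ∑-cong-≈ (λ j → *-congʳ (a j) (ι-scale k k⊥m (π ⟨$⟩ˡ j))) ⟩
    ∑[ j < m ] (k * position π j * a j)
      ≡⟨ sum-cong-≗ (λ j → ℤP.*-assoc k (position π j) (a j)) ⟩
    ∑[ j < m ] (k * (position π j * a j))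
      ≡⟨ *-distribˡ-sum k (λ j → position π j * a j) ⟨
    k * ∑[ j < m ] (position π j * a j)
      ≡⟨ cong (k *_) (permSum≡∑position a π) ⟨
    k * permSum m a π
      ≈⟨ *-congˡ k (≡[mod]⇒≈ s) ⟩
    k * w
      ∎)
    where
      σ : Permutation′ m
      σ = scale k k⊥m

  -- φ m is by definition the length of this list
  units : List ℕ
  units = filter (λ k → coprime? k m) (map suc (upTo m))

  private
    lookup-units : ∀ i → lookup units i ∈ map suc (upTo m) × Coprime (lookup units i) m
    lookup-units i = ∈.∈-filter⁻ (λ k → coprime? k m) {xs = map suc (upTo m)} (∈.∈-lookup i)

    units-unique : Unique units
    units-unique = Unique.filter⁺ (λ k → coprime? k m) (Unique.map⁺ ℕP.suc-injective (Unique.upTo⁺ m))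

    units≡suc : ∀ i → ∃ λ x → x ℕ.< m × lookup units i ≡ suc x
    units≡suc i with ∈.∈-map⁻ suc (proj₁ (lookup-units i))
    ... | x , x∈upTo , uᵢ≡1+x = x , ∈.∈-upTo⁻ x∈upTo , uᵢ≡1+x

  units-coprime : ∀ i → Coprime (lookup units i) m
  units-coprime i = proj₂ (lookup-units i)

  units-injective : ∀ i j → + lookup units i ≈ + lookup units j → i ≡ j
  units-injective i j uᵢ≈uⱼ with units≡suc i | units≡suc j
  ... | x , x<m , uᵢ≡1+x | y , y<m , uⱼ≡1+y =
    lookup-injective units-unique (trans uᵢ≡1+x (trans (cong suc x≡y) (sym uⱼ≡1+y)))
    where
      x≡y : x ≡ y
      x≡y = ≈⇒≡-below x<m y<m
              (+-cancelˡ-≈ 1ℤ (subst₂ _≈_ (cong +_ uᵢ≡1+x) (cong +_ uⱼ≡1+y) uᵢ≈uⱼ))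

  φ-distinct-IsPermSums : ∀ a {w} → IsPermSum m a w → Coprime ∣ w ∣ m →
    ∃ λ (f : Fin (φ m) → ℤ) → (∀ i → IsPermSum m a (f i)) × (∀ i j → f i ≡ f j [mod m ] → i ≡ j)
  φ-distinct-IsPermSums a {w} s w⊥m =
      (λ i → + lookup units i * w)
    , (λ i → IsPermSum-*ˡ a (+ lookup units i) (units-coprime i) s)
    , λ i j uᵢw≡uⱼw → units-injective i j (*-cancelˡ-≈ w w⊥m (begin
        w * + lookup units i   ≡⟨ ℤP.*-comm w _ ⟩
        + lookup units i * w   ≈⟨ ≡[mod]⇒≈ uᵢw≡uⱼw ⟩
        + lookup units j * w   ≡⟨ ℤP.*-comm _ w ⟩
        w * + lookup units j   ∎))

module SpecialSequence (n : ℕ) where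
  open Congruence (2+ n)
  open Residues (2+ n)

  permSum-specialSeq : ∀ a b π → permSum (2+ n) (specialSeq (2+ n) a b) π
                                 ≡ a * ∑[ j < 2+ n ] position π j + b * (position π 0F - position π 1F)
  permSum-specialSeq a b π = begin
    permSum (2+ n) (specialSeq (2+ n) a b) π
      ≡⟨ permSum≡∑position (specialSeq (2+ n) a b) π ⟩
    p 0F * (a + b) + (p 1F * (a - b) + ∑[ j < n ] (p (Fin.suc (Fin.suc j)) * a))
      ≡⟨ cong (λ z → p 0F * (a + b) + (p 1F * (a - b) + z)) (*-distribʳ-sum a (p ∘ Fin.suc ∘ Fin.suc)) ⟨
    p 0F * (a + b) + (p 1F * (a - b) + rest * a)
      ≡⟨ expand (p 0F) (p 1F) rest a b ⟩
    a * ∑[ j < 2+ n ] p j + b * (p 0F - p 1F)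
      ∎
    where
      open ≡-Reasoning
      p : Fin (2+ n) → ℤ
      p = position π
      rest : ℤ
      rest = ∑[ j < n ] p (Fin.suc (Fin.suc j))
      expand : ∀ p₀ p₁ r a b → p₀ * (a + b) + (p₁ * (a - b) + r * a) ≡ a * (p₀ + (p₁ + r)) + b * (p₀ - p₁)
      expand = solve-∀

  module _ (2∤m : ¬ 2 ℕD.∣ 2+ n) (a b : ℤ) (b⊥m : Coprime ∣ b ∣ (2+ n)) where

    permSum-specialSeq≈ : ∀ π → permSum (2+ n) (specialSeq (2+ n) a b) π ≈ b * (position π 0F - position π 1F)
    permSum-specialSeq≈ π = begin
      permSum (2+ n) (specialSeq (2+ n) a b) π          ≡⟨ permSum-specialSeq a b π ⟩
      a * ∑[ j < 2+ n ] position π j + b * d            ≡⟨ cong (λ s → a * s + b * d) (∑position≡∑ι π) ⟩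
      a * ∑[ i < 2+ n ] ι i + b * d                     ≈⟨ +-cong (*-congˡ a (∑ι≈0 2∤m)) (≈-refl {b * d}) ⟩
      a * 0ℤ + b * d                                    ≡⟨ drop (b * d) ⟩
      b * d                                             ∎
      where
        open ≈-Reasoning
        d = position π 0F - position π 1F
        drop : ∀ x → a * 0ℤ + x ≡ x
        drop x = trans (cong (_+ x) (ℤP.*-zeroʳ a)) (ℤP.+-identityˡ x)

    specialSeq-¬IsPermSum0 : ¬ IsPermSum (2+ n) (specialSeq (2+ n) a b) 0ℤ
    specialSeq-¬IsPermSum0 (π , s) = 0F≢1F (begin
      0F                      ≡⟨ Perm.inverseʳ π ⟨
      π ⟨$⟩ʳ (π ⟨$⟩ˡ 0F)      ≡⟨ cong (π ⟨$⟩ʳ_) (ι-injective p₀≈p₁) ⟩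
      π ⟨$⟩ʳ (π ⟨$⟩ˡ 1F)      ≡⟨ Perm.inverseʳ π ⟩
      1F                      ∎)
      where
        open ≡-Reasoning
        0F≢1F : 0F ≢ 1F
        0F≢1F ()
        p₀≈p₁ : position π 0F ≈ position π 1F
        p₀≈p₁ = x-y≈0⇒x≈y (*-cancelˡ-≈ b b⊥m (≈-trans (≈-sym (permSum-specialSeq≈ π))
                                            (≈-trans (≡[mod]⇒≈ s) (≡⇒≈ (sym (ℤP.*-zeroʳ b))))))

    specialSeq-IsPermSum : ∀ w → ¬ (w ≡ 0ℤ [mod 2+ n ]) → IsPermSum (2+ n) (specialSeq (2+ n) a b) w
    specialSeq-IsPermSum w w≢0 with ∃-inverse b b⊥m
    ... | u , u*b≈1 = Perm.flip σ , ≈⇒≡[mod] (begin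
      permSum (2+ n) (specialSeq (2+ n) a b) (Perm.flip σ)
        ≈⟨ permSum-specialSeq≈ (Perm.flip σ) ⟩
      b * (ι (σ ⟨$⟩ʳ 0F) - ι (σ ⟨$⟩ʳ 1F))
        ≡⟨ cong₂ (λ i j → b * (ι i - ι j)) (cycle-0p1-0 Q Q≢0) (cycle-0p1-1 Q) ⟩
      b * (ι Q - 1ℤ)
        ≈⟨ *-congˡ b (+-cong (ι-residue (t + 1ℤ)) (≈-refl { - 1ℤ})) ⟩
      b * (t + 1ℤ - 1ℤ)
        ≡⟨ cong (b *_) (unshift t) ⟩
      b * t
        ≈⟨ b*t≈w ⟩
      w
        ∎)
      where
        open ≈-Reasoning
        -- put a - b in place 1 and a + b in place t + 1, where b t ≡ w
        t : ℤ
        t = u * w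
        b*t≈w : b * t ≈ w
        b*t≈w = begin
          b * (u * w)    ≡⟨ ℤP.*-assoc b u w ⟨
          b * u * w      ≈⟨ *-congʳ w (≈-trans (≡⇒≈ (ℤP.*-comm b u)) u*b≈1) ⟩
          1ℤ * w         ≡⟨ ℤP.*-identityˡ w ⟩
          w              ∎
        Q : Fin (2+ n)
        Q = residue (t + 1ℤ)
        Q≢0 : Q ≢ 0F
        Q≢0 Q≡0 = w≢0 (≈⇒≡[mod] (begin
          w          ≈⟨ b*t≈w ⟨
          b * t      ≈⟨ *-congˡ b t≈0 ⟩
          b * 0ℤ     ≡⟨ ℤP.*-zeroʳ b ⟩
          0ℤ         ∎))
          where
            t≈0 : t ≈ 0ℤ
            t≈0 = +-cancelˡ-≈ 1ℤ (begin
              1ℤ + t       ≡⟨ ℤP.+-comm 1ℤ t ⟩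
              t + 1ℤ       ≈⟨ ι-residue (t + 1ℤ) ⟨
              ι Q          ≡⟨ cong ι Q≡0 ⟩
              1ℤ + 0ℤ      ∎)
        σ : Permutation′ (2+ n)
        σ = cycle-0p1 Q
        unshift : ∀ t → t + 1ℤ - 1ℤ ≡ t
        unshift = solve-∀

specialSeq-permSums : ∀ {m} → ¬ 2 ℕD.∣ m → 3 ≤ m → (a b : ℤ) → Coprime ∣ b ∣ m →
  ((w : ℤ) → ¬ (w ≡ 0ℤ [mod m ]) → IsPermSum m (specialSeq m a b) w)
  × ¬ IsPermSum m (specialSeq m a b) 0ℤ
specialSeq-permSums {suc zero} _ (s≤s ())
specialSeq-permSums {2+ n} 2∤m _ a b b⊥m = specialSeq-IsPermSum 2∤m a b b⊥m , specialSeq-¬IsPermSum0 2∤m a b b⊥m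
  where open SpecialSequence n

lemma2p2 : (m : ℕ) → 1 ≤ m → ¬ (2 ℕD.∣ m) →
    ((a : Fin m → ℤ) → ¬ IsPermSum m a 0ℤ →
       ((c : ℤ) → ¬ IsPermSum m (λ i → a i + c) 0ℤ)
       × ((c : ℤ) → Coprime ∣ c ∣ m → ¬ IsPermSum m (λ i → c * a i) 0ℤ))
    × ((a : Fin m → ℤ) → (w : ℤ) → IsPermSum m a w →
       ((k : ℤ) → Coprime ∣ k ∣ m → IsPermSum m a (k * w))
       × (Coprime ∣ w ∣ m →
          ∃ λ (f : Fin (φ m) → ℤ) →
            ((i : Fin (φ m)) → IsPermSum m a (f i))
            × ((i j : Fin (φ m)) → f i ≡ f j [mod m ] → i ≡ j)))
    × (3 ≤ m → (a b : ℤ) → Coprime ∣ b ∣ m →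
       ((w : ℤ) → ¬ (w ≡ 0ℤ [mod m ]) → IsPermSum m (specialSeq m a b) w)
       × ¬ IsPermSum m (specialSeq m a b) 0ℤ)
lemma2p2 m@(suc _) _ 2∤m =
    (λ a ¬0 → (λ c → ¬0 ∘ IsPermSum-translate 2∤m a c {0ℤ})
            , (λ c c⊥m → ¬0 ∘ IsPermSum-dilate a c {0ℤ} c⊥m
                           ∘ subst (IsPermSum m (λ i → c * a i)) (sym (ℤP.*-zeroʳ c))))
  , (λ a w s → (λ k k⊥m → IsPermSum-*ˡ a k k⊥m s) , φ-distinct-IsPermSums a s)
  , specialSeq-permSums 2∤m
  where open PermutationalSums m
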